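{- Let $G$ be a niche-realizable graph and $S\subseteq V(G)$. If the induced subgraph $G[S]$ is connected, regular, and not complete, then there are positive integers $l$ and $t$ such that $G[S]$ is obtained from a complete multipartite graph with $l$ partite sets, each of size two, by replacing each vertex with a clique of size $t$.
   Context: All graphs are simple. A bipartite tournament is an orientation of a complete bipartite graph. The niche graph of a digraph $D$ is the graph with vertex set $V(D)$ in which distinct $u,v$ are adjacent iff there is a vertex $w$ with $(u,w),(v,w)\in A(D)$, or with $(w,u),(w,v)\in A(D)$. A graph is niche-realizable if it is the niche graph of some bipartite tournament. Replacing a vertex $v$ of $H$ with a clique formed by a finite set $K$ disjoint from $V(H)$ gives the graph with vertex set $(V(H)\cup K)\setminus\{v\}$ and edge set $E(H-v)\cup\{wx: w\neq x,\ w,x\in K\}\cup\{uw: uv\in E(H), w\in K\}$. -}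

module Defs where

open import Data.Bool using (Bool; true; false)
open import Data.Nat using (ℕ)
open import Data.Fin using (Fin)
open import Data.Fin.Subset using (Subset; _∈_)
open import Data.Product using (Σ; ∃; _×_; _,_)
open import Data.Sum using (_⊎_)
open import Relation.Binary.PropositionalEquality using (_≡_; _≢_)
open import Relation.Nullary using (¬_)
open import Function.Bundles using (_⇔_; _↔_; Inverse)

record Graph (n : ℕ) : Set where
  field
    adj    : Fin n → Fin n → Bool
    sym    : ∀ u v → adj u v ≡ adj v u
    irrefl : ∀ v → adj v v ≡ false

Edge : ∀ {n} → Graph n → Fin n → Fin n → Set
Edge G u v = Graph.adj G u v ≡ true

-- Bipartite tournaments on vertex set Fin n:
-- an orientation of the complete bipartite graph with bipartition given
-- by `side`: no arcs inside a part, and between any two vertices of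
-- different parts exactly one of the two arcs.

record BipartiteTournament (n : ℕ) : Set where
  field
    side     : Fin n → Bool
    arc      : Fin n → Fin n → Bool
    arc⇒cross : ∀ u v → arc u v ≡ true → side u ≢ side v
    cross⇒orient : ∀ u v → side u ≢ side v →
      (arc u v ≡ true × arc v u ≡ false) ⊎ (arc u v ≡ false × arc v u ≡ true)

Arc : ∀ {n} → BipartiteTournament n → Fin n → Fin n → Set
Arc D u v = BipartiteTournament.arc D u v ≡ true

NicheAdj : ∀ {n} → BipartiteTournament n → Fin n → Fin n → Set
NicheAdj D u v =
  u ≢ v × ((∃ λ w → Arc D u w × Arc D v w) ⊎ (∃ λ w → Arc D w u × Arc D w v))

NicheRealizable : ∀ {n} → Graph n → Set
NicheRealizable {n} G =
  Σ (BipartiteTournament n) λ D → ∀ u v → Edge G u v ⇔ NicheAdj D u v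

record SGraph : Set₁ where
  field
    V : Set
    E : V → V → Set

open SGraph public

induced : ∀ {n} → Graph n → Subset n → SGraph
induced {n} G S = record
  { V = Σ (Fin n) (λ v → v ∈ S)
  ; E = λ { (u , _) (v , _) → Edge G u v } }

data Reach (H : SGraph) : V H → V H → Set where
  here : ∀ {u} → Reach H u u
  step : ∀ {u v w} → E H u v → Reach H v w → Reach H u w

Connected : SGraph → Set
Connected H = ∀ u v → Reach H u v

Regular : SGraph → Set
Regular H = ∃ λ (k : ℕ) → ∀ v → (Σ (V H) λ w → E H v w) ↔ Fin k

Complete : SGraph → Set
Complete H = ∀ u v → u ≢ v → E H u v

CompleteMultipartite : ℕ → ℕ → SGraph
CompleteMultipartite l s = record
  { V = Fin l × Fin s
  ; E = λ { (i , _) (j , _) → i ≢ j } }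

replaceByCliques : SGraph → ℕ → SGraph
replaceByCliques H t = record
  { V = V H × Fin t
  ; E = λ { (v , x) (w , y) → (v ≡ w × x ≢ y) ⊎ E H v w } }

Isomorphic : SGraph → SGraph → Set
Isomorphic H K = Σ (V H ↔ V K) λ f →
  ∀ u v → E H u v ⇔ E K (Inverse.to f u) (Inverse.to f v)

-- All vertices of a connected induced subgraph G[S] of a niche graph lie in one part of the
-- bipartite tournament, and two of them are non-adjacent exactly when their out-neighbourhoods
-- in the other part are complementary.  Complementing three times complements, so in the
-- complement c of G[S] every walk i—j—k—l has i adjacent to l: each component of c is complete
-- bipartite, and since c is regular of positive degree t, c is l disjoint copies of K_{t,t}.
-- The complement of l·K_{t,t} is K_{2,…,2} with every vertex replaced by a t-clique.

module Submission where

open import Defs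
open import Data.Bool using (Bool; true; false; not; _∧_; _∨_; if_then_else_) renaming (_≟_ to _≟ᵇ_)
open import Data.Bool.Properties using (¬-not; not-¬; not-involutive; ∨-identityʳ; ∨-zeroʳ; ∨-comm)
open import Data.Fin using (Fin; zero; suc)
open import Data.Fin.Permutation using (↔⇒≡)
open import Data.Fin.Properties using (_≟_; 1↔⊤; 2↔Bool; +↔⊎; any?; nonZeroIndex)
open import Data.Fin.Subset using (Subset; _∈_)
open import Data.Fin.Subset.Properties using (_∈?_)
open import Data.Maybe using (Maybe; just; nothing)
import Data.Maybe as Maybe
open import Data.Maybe.Properties using (just-injective)
open import Data.Nat using (ℕ; zero; suc; _+_; _∸_; _≥_; s≤s; z≤n; >-nonZero⁻¹)
open import Data.Nat.Properties using (m+n∸m≡n)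
open import Data.Product using (Σ; ∃; ∃₂; _×_; _,_; proj₁; proj₂)
open import Data.Product.Function.Dependent.Propositional using (Σ-↔)
open import Data.Product.Properties using (Σ-≡,≡→≡)
open import Data.Sum using (_⊎_; inj₁; inj₂)
open import Data.Sum.Function.Propositional using (_⊎-↔_)
open import Data.Unit using (⊤; tt)
open import Data.Vec.Properties.WithK using ([]=-irrelevant)
open import Function using (_∘_)
open import Function.Bundles using (_⇔_; _↔_; Inverse; Equivalence; Injection; mk↔ₛ′; mk⇔)
open import Function.Properties.Equivalence using () renaming (trans to ⇔-trans)
open import Function.Properties.Inverse using (↔-refl; ↔-sym; ↔-trans; ↔⇒↣)
open import Relation.Binary.PropositionalEquality
open import Relation.Binary.PropositionalEquality.WithK using (≡-irrelevant)
open import Relation.Nullary using (¬_; Dec; yes; no; does; Irrelevant; contradiction)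
open import Relation.Unary using (Decidable)

private
  variable
    m k t : ℕ

to-injective : ∀ {A B : Set} (e : A ↔ B) {x y : A} → Inverse.to e x ≡ Inverse.to e y → x ≡ y
to-injective e = Injection.injective (↔⇒↣ e)

∨-false : ∀ {x} → x ∨ false ≡ true → x ≡ true
∨-false {x} x∨false = trans (sym (∨-identityʳ x)) x∨false

≢-same⇒≡ : ∀ {x y z : Bool} → x ≢ z → y ≢ z → x ≡ y
≢-same⇒≡ x≢z y≢z = trans (¬-not x≢z) (sym (¬-not y≢z))

complement : SGraph → SGraph
complement H = record { V = V H ; E = λ u v → u ≢ v × ¬ E H u v }

transport : (H : SGraph) {A : Set} → V H ↔ A → SGraph
transport H {A} e = record { V = A ; E = λ i j → E H (Inverse.from e i) (Inverse.from e j) }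

≅-of-⇔ : ∀ {A : Set} {E E′ : A → A → Set} → (∀ u v → E u v ⇔ E′ u v) →
  Isomorphic (record { V = A ; E = E }) (record { V = A ; E = E′ })
≅-of-⇔ E⇔E′ = ↔-refl , E⇔E′

module ≅-Reasoning where
  infix 1 begin_
  infixr 2 _≅⟨_⟩_
  infix 3 _∎

  record _≅_ (H K : SGraph) : Set where
    constructor chain
    field isomorphic : Isomorphic H K

  begin_ : ∀ {H K} → H ≅ K → Isomorphic H K
  begin chain H≅K = H≅K

  _≅⟨_⟩_ : ∀ H {K L} → Isomorphic H K → K ≅ L → H ≅ L
  H ≅⟨ f , f-edge ⟩ chain (g , g-edge) = chain (↔-trans f g , λ u v → ⇔-trans (f-edge u v) (g-edge _ _))

  _∎ : ∀ H → H ≅ H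
  H ∎ = chain (↔-refl , λ u v → mk⇔ (λ e → e) (λ e → e))

≅-transport : (H : SGraph) {A : Set} (e : V H ↔ A) → Isomorphic H (transport H e)
≅-transport H e = e , λ u v → mk⇔ (subst₂ (E H) (sym (from∘to u)) (sym (from∘to v)))
                                    (subst₂ (E H) (from∘to u) (from∘to v))
  where from∘to = Inverse.strictlyInverseʳ e

≅-complement : ∀ {H K} → Isomorphic H K → Isomorphic (complement H) (complement K)
≅-complement (f , f-edge) = f , λ u v → mk⇔
  (λ (u≢v , ¬e) → u≢v ∘ to-injective f , ¬e ∘ Equivalence.from (f-edge u v))
  (λ (fu≢fv , ¬e) → fu≢fv ∘ cong (Inverse.to f) , ¬e ∘ Equivalence.to (f-edge u v))

Complete-≅ : ∀ {H K} → Isomorphic H K → Complete K → Complete H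
Complete-≅ (f , f-edge) complete u v u≢v =
  Equivalence.from (f-edge u v) (complete _ _ (u≢v ∘ to-injective f))

transport-regular : (H : SGraph) {A : Set} (e : V H ↔ A) → Regular H → Regular (transport H e)
transport-regular H e (k , nbrs) = k , λ i → ↔-trans (Σ-↔ (↔-sym e) ↔-refl) (nbrs (Inverse.from e i))

reach⇒edge : ∀ {H u v} → Reach H u v → u ≢ v → ∃ λ w → E H u w
reach⇒edge here u≢u = contradiction refl u≢u
reach⇒edge (step {v = w} e _) _ = w , e

-- ((a , s) , x) is the x-th vertex on side s of the a-th copy of K_{t,t}
copiesOfCompleteBipartite : ℕ → ℕ → SGraph
copiesOfCompleteBipartite l t = record
  { V = (Fin l × Fin 2) × Fin t
  ; E = λ { ((a , s) , _) ((b , s′) , _) → a ≡ b × s ≢ s′ } }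

complement-copiesOfCompleteBipartite : ∀ l t →
  Isomorphic (complement (copiesOfCompleteBipartite l t)) (replaceByCliques (CompleteMultipartite l 2) t)
complement-copiesOfCompleteBipartite l t = ≅-of-⇔ λ u v → mk⇔ (fwd u v) (bwd u v)
  where
  fwd : ∀ u v → E (complement (copiesOfCompleteBipartite l t)) u v →
        E (replaceByCliques (CompleteMultipartite l 2) t) u v
  fwd ((a , s) , x) ((b , s′) , y) (u≢v , ¬opposite) with a ≟ b | s ≟ s′
  ... | no a≢b | _ = inj₂ a≢b
  ... | yes a≡b | no s≢s′ = contradiction (a≡b , s≢s′) ¬opposite
  ... | yes refl | yes refl = inj₁ (refl , λ { refl → u≢v refl })
  bwd : ∀ u v → E (replaceByCliques (CompleteMultipartite l 2) t) u v →
        E (complement (copiesOfCompleteBipartite l t)) u v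
  bwd _ _ (inj₁ (refl , x≢y)) = (λ { refl → x≢y refl }) , λ (_ , s≢s) → s≢s refl
  bwd _ _ (inj₂ a≢b) = (λ { refl → a≢b refl }) , λ (a≡b , _) → a≢b a≡b

Σ-Fin-suc↔ : (P : Fin (suc m) → Set) → Σ (Fin (suc m)) P ↔ (P zero ⊎ Σ (Fin m) (P ∘ suc))
Σ-Fin-suc↔ P = mk↔ₛ′
  (λ { (zero , p) → inj₁ p ; (suc i , p) → inj₂ (i , p) })
  (λ { (inj₁ p) → zero , p ; (inj₂ (i , p)) → suc i , p })
  (λ { (inj₁ _) → refl ; (inj₂ _) → refl })
  (λ { (zero , _) → refl ; (suc _ , _) → refl })

count : (P : Fin m → Set) → Decidable P → (∀ {i} → Irrelevant (P i)) → ∃ λ k → Σ (Fin m) P ↔ Fin k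
count {zero} P P? P-irr = 0 , mk↔ₛ′ (λ ()) (λ ()) (λ ()) (λ ())
count {suc m} P P? P-irr with count (P ∘ suc) (P? ∘ suc) P-irr | P? zero
... | k , Σ↔k | yes p = suc k ,
  ↔-trans (Σ-Fin-suc↔ P) (↔-trans (P0↔⊤ ⊎-↔ Σ↔k) (↔-sym (↔-trans +↔⊎ (1↔⊤ ⊎-↔ ↔-refl))))
  where P0↔⊤ = mk↔ₛ′ (λ _ → tt) (λ _ → p) (λ _ → refl) (P-irr p)
... | k , Σ↔k | no ¬p = k , ↔-trans (Σ-Fin-suc↔ P) (↔-trans drop-inj₁ Σ↔k)
  where drop-inj₁ = mk↔ₛ′ (λ { (inj₁ p) → contradiction p ¬p ; (inj₂ x) → x }) inj₂
                          (λ _ → refl) (λ { (inj₁ p) → contradiction p ¬p ; (inj₂ _) → refl })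

BoolRel : ℕ → Set
BoolRel m = Fin m → Fin m → Bool

Nbr : BoolRel m → Fin m → Set
Nbr {m} R i = Σ (Fin m) λ j → R i j ≡ true

boolGraph : BoolRel m → SGraph
boolGraph {m} R = record { V = Fin m ; E = λ i j → R i j ≡ true }

co : BoolRel m → BoolRel m
co R i j = not (does (i ≟ j)) ∧ not (R i j)

module _ (R : BoolRel m) where

  co-intro : ∀ {i j} → i ≢ j → R i j ≡ false → co R i j ≡ true
  co-intro {i} {j} i≢j Rij≡false with i ≟ j
  ... | yes i≡j = contradiction i≡j i≢j
  ... | no _ rewrite Rij≡false = refl

  co⇒≢ : ∀ {i j} → co R i j ≡ true → i ≢ j
  co⇒≢ {i} {j} coRij i≡j with i ≟ j
  co⇒≢ {i} {j} () i≡j | yes _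
  ... | no i≢j = i≢j i≡j

  co⇒false : ∀ {i j} → co R i j ≡ true → R i j ≡ false
  co⇒false {i} {j} coRij with i ≟ j | R i j
  co⇒false {i} {j} () | yes _ | _
  co⇒false {i} {j} () | no _ | true
  ... | no _ | false = refl

  co-irrefl : ∀ i → co R i i ≡ false
  co-irrefl i with i ≟ i
  ... | yes _ = refl
  ... | no i≢i = contradiction refl i≢i

  co-sym : (∀ i j → R i j ≡ R j i) → ∀ {i j} → co R i j ≡ true → co R j i ≡ true
  co-sym R-sym {i} {j} coRij =
    co-intro (co⇒≢ coRij ∘ sym) (trans (R-sym j i) (co⇒false coRij))

  ⇔≢×¬co : (∀ i → R i i ≡ false) → ∀ i j → R i j ≡ true ⇔ (i ≢ j × ¬ co R i j ≡ true)
  ⇔≢×¬co R-irrefl i j = mk⇔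
    (λ Rij → (λ { refl → contradiction (trans (sym Rij) (R-irrefl i)) λ () })
           , λ coRij → contradiction (trans (sym Rij) (co⇒false coRij)) λ ())
    (λ (i≢j , ¬coRij) → ¬-not (λ Rij≡false → ¬coRij (co-intro i≢j Rij≡false)))

  Fin↔self⊎Nbr⊎coNbr : (∀ i → R i i ≡ false) → ∀ i → Fin m ↔ (⊤ ⊎ (Nbr R i ⊎ Nbr (co R) i))
  Fin↔self⊎Nbr⊎coNbr R-irrefl i = mk↔ₛ′ classify vertex classify∘vertex vertex∘classify
    where
    classifyBy : ∀ j → Dec (i ≡ j) → ∀ b → R i j ≡ b → ⊤ ⊎ (Nbr R i ⊎ Nbr (co R) i)
    classifyBy j (yes _) _ _ = inj₁ tt
    classifyBy j (no _) true Rij = inj₂ (inj₁ (j , Rij))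
    classifyBy j (no i≢j) false Rij = inj₂ (inj₂ (j , co-intro i≢j Rij))
    classify : Fin m → ⊤ ⊎ (Nbr R i ⊎ Nbr (co R) i)
    classify j = classifyBy j (i ≟ j) (R i j) refl
    vertex : ⊤ ⊎ (Nbr R i ⊎ Nbr (co R) i) → Fin m
    vertex (inj₁ _) = i
    vertex (inj₂ (inj₁ (j , _))) = j
    vertex (inj₂ (inj₂ (j , _))) = j
    vertex∘classifyBy : ∀ j i≟j b Rij → vertex (classifyBy j i≟j b Rij) ≡ j
    vertex∘classifyBy j (yes i≡j) _ _ = i≡j
    vertex∘classifyBy j (no _) true _ = refl
    vertex∘classifyBy j (no _) false _ = refl
    vertex∘classify : ∀ j → vertex (classify j) ≡ j
    vertex∘classify j = vertex∘classifyBy j (i ≟ j) (R i j) refl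
    classify∘vertex : ∀ x → classify (vertex x) ≡ x
    classify∘vertex (inj₁ tt) = self (i ≟ i) (R i i) refl
      where
      self : ∀ i≟i b Rii → classifyBy i i≟i b Rii ≡ inj₁ tt
      self (yes _) _ _ = refl
      self (no i≢i) _ _ = contradiction refl i≢i
    classify∘vertex (inj₂ (inj₁ (j , Rij))) = nbr (i ≟ j) (R i j) refl
      where
      nbr : ∀ i≟j b Rij′ → classifyBy j i≟j b Rij′ ≡ inj₂ (inj₁ (j , Rij))
      nbr (yes refl) _ _ = contradiction (trans (sym Rij) (R-irrefl i)) λ ()
      nbr (no _) true Rij′ = cong (λ p → inj₂ (inj₁ (j , p))) (≡-irrelevant Rij′ Rij)
      nbr (no _) false Rij′ = contradiction (trans (sym Rij) Rij′) λ ()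
    classify∘vertex (inj₂ (inj₂ (j , coRij))) = nonNbr (i ≟ j) (R i j) refl
      where
      nonNbr : ∀ i≟j b Rij′ → classifyBy j i≟j b Rij′ ≡ inj₂ (inj₂ (j , coRij))
      nonNbr (yes i≡j) _ _ = contradiction i≡j (co⇒≢ coRij)
      nonNbr (no _) true Rij′ = contradiction (trans (sym Rij′) (co⇒false coRij)) λ ()
      nonNbr (no _) false _ = cong (λ p → inj₂ (inj₂ (j , p))) (≡-irrelevant _ coRij)

  co-regular : (∀ i → R i i ≡ false) → (∀ i → Nbr R i ↔ Fin k) → ∀ i → Nbr (co R) i ↔ Fin (m ∸ suc k)
  co-regular {k} R-irrefl nbrs i
    with count (λ j → co R i j ≡ true) (λ j → co R i j ≟ᵇ true) ≡-irrelevant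
  ... | d , coNbr↔d = subst (λ d → Nbr (co R) i ↔ Fin d) d≡m∸1+k coNbr↔d
    where
    m≡1+k+d : m ≡ suc k + d
    m≡1+k+d = ↔⇒≡ (↔-trans (Fin↔self⊎Nbr⊎coNbr R-irrefl i)
                  (↔-trans (↔-sym 1↔⊤ ⊎-↔ ↔-trans (nbrs i ⊎-↔ coNbr↔d) (↔-sym +↔⊎)) (↔-sym +↔⊎)))
    d≡m∸1+k : d ≡ m ∸ suc k
    d≡m∸1+k = trans (sym (m+n∸m≡n (suc k) d)) (cong (_∸ suc k) (sym m≡1+k+d))

first : (Fin m → Bool) → Maybe (Fin m)
first {zero} p = nothing
first {suc m} p = if p zero then just zero else Maybe.map suc (first (p ∘ suc))

first-cong : (p q : Fin m → Bool) → (∀ i → p i ≡ q i) → first p ≡ first q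
first-cong {zero} p q p≗q = refl
first-cong {suc m} p q p≗q = cong₂ (λ b r → if b then just zero else Maybe.map suc r)
  (p≗q zero) (first-cong (p ∘ suc) (q ∘ suc) (p≗q ∘ suc))

first-complete : (p : Fin m → Bool) {i : Fin m} → p i ≡ true → ∃ λ j → first p ≡ just j × p j ≡ true
first-complete {suc m} p {i} pi with p zero in p0
... | true = zero , refl , p0
first-complete {suc m} p {zero} pi | false = contradiction (trans (sym p0) pi) λ ()
first-complete {suc m} p {suc i} pi | false with first-complete (p ∘ suc) pi
... | j , first≡j , pj = suc j , cong (Maybe.map suc) first≡j , pj

module CompleteBipartiteComponents (c : BoolRel m)
  (c-irrefl : ∀ i → c i i ≡ false)
  (c-sym : ∀ {i j} → c i j ≡ true → c j i ≡ true)
  (c-closed : ∀ {i j k l} → c i j ≡ true → c j k ≡ true → c k l ≡ true → c i l ≡ true)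
  (nbrs : ∀ i → Nbr c i ↔ Fin (suc t)) where

  ¬c-refl : ∀ {i} → ¬ c i i ≡ true
  ¬c-refl {i} cii = contradiction (trans (sym cii) (c-irrefl i)) λ ()

  partner : Fin m → Fin m
  partner i = proj₁ (Inverse.from (nbrs i) zero)

  c-partner : ∀ i → c i (partner i) ≡ true
  c-partner i = proj₂ (Inverse.from (nbrs i) zero)

  c-twins : ∀ {i z j} → c i z ≡ true → c z j ≡ true → ∀ k → c i k ≡ c j k
  c-twins {i} {z} {j} iz zj k with c i k in ik | c j k in jk
  ... | true | true = refl
  ... | false | false = refl
  ... | true | false = trans (sym (c-closed (c-sym zj) (c-sym iz) ik)) jk
  ... | false | true = trans (sym ik) (c-closed iz zj jk)

  -- The component of i is complete bipartite with sides N(partner i) ∋ i and N(i).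
  component : BoolRel m
  component i j = c i j ∨ c (partner i) j

  component-refl : ∀ i → component i i ≡ true
  component-refl i rewrite c-irrefl i = c-sym (c-partner i)

  component-twins : ∀ {i j} → component i j ≡ true → ∀ k → component i k ≡ component j k
  component-twins {i} {j} ij k with c i j in c-ij
  ... | true = trans (cong₂ _∨_ (c-twins c-ij (c-partner j) k) (c-twins (c-sym (c-partner i)) c-ij k))
                     (∨-comm (c (partner j) k) (c j k))
  ... | false = cong₂ _∨_ (c-twins (c-partner i) ij k) (c-twins ij (c-partner j) k)

  component-sym : ∀ {i j} → component i j ≡ true → component j i ≡ true
  component-sym {i} {j} ij = trans (sym (component-twins ij i)) (component-refl i)

  rep-spec : ∀ i → ∃ λ ρ → first (component i) ≡ just ρ × component i ρ ≡ true
  rep-spec i = first-complete (component i) (component-refl i)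

  rep : Fin m → Fin m
  rep i = proj₁ (rep-spec i)

  rep-cong : ∀ {i j} → component i j ≡ true → rep i ≡ rep j
  rep-cong {i} {j} ij = just-injective (begin
    just (rep i)           ≡⟨ sym (proj₁ (proj₂ (rep-spec i))) ⟩
    first (component i)    ≡⟨ first-cong _ _ (component-twins ij) ⟩
    first (component j)    ≡⟨ proj₁ (proj₂ (rep-spec j)) ⟩
    just (rep j)           ∎)
    where open ≡-Reasoning

  component-rep : ∀ i → component (rep i) i ≡ true
  component-rep i = component-sym (proj₂ (proj₂ (rep-spec i)))

  rep-idem : ∀ i → rep (rep i) ≡ rep i
  rep-idem i = sym (rep-cong (component-sym (component-rep i)))

  c⇒component : ∀ {i j} → c i j ≡ true → component i j ≡ true
  c⇒component {i} {j} cij = cong (_∨ c (partner i) j) cij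

  pole : Fin m → Fin 2 → Fin m
  pole ρ zero = ρ
  pole ρ (suc zero) = partner ρ

  partOf : Fin m → Fin m → Fin 2
  partOf ρ i = Inverse.from 2↔Bool (c (partner ρ) i)

  c-within : ∀ {ρ i j} → component ρ i ≡ true → component ρ j ≡ true →
             c i j ≡ true ⇔ partOf ρ i ≢ partOf ρ j
  c-within {ρ} {i} {j} ρi ρj with c (partner ρ) i in pi | c (partner ρ) j in pj
  ... | true | true = mk⇔ (λ ij _ → ¬c-refl (c-closed ij (c-sym pj) pi)) (λ ne → contradiction refl ne)
  ... | false | false = mk⇔ (λ ij _ → ¬c-refl (c-closed (c-sym (∨-false ρi)) (∨-false ρj) (c-sym ij)))
                            (λ ne → contradiction refl ne)
  ... | true | false = mk⇔ (λ _ ()) (λ _ → c-closed (c-sym pi) (c-sym (c-partner ρ)) (∨-false ρj))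
  ... | false | true = mk⇔ (λ _ ()) (λ _ → c-closed (c-sym (∨-false ρi)) (c-partner ρ) pj)

  c-pole : ∀ {ρ i} → component ρ i ≡ true → c (pole ρ (partOf ρ i)) i ≡ true
  c-pole {ρ} {i} ρi with c (partner ρ) i in pi
  ... | true = pi
  ... | false = ∨-false ρi

  pole⇒component : ∀ {ρ} s {i} → c (pole ρ s) i ≡ true → component ρ i ≡ true
  pole⇒component zero ρi = c⇒component ρi
  pole⇒component {ρ} (suc zero) {i} pi = trans (cong (c ρ i ∨_) pi) (∨-zeroʳ (c ρ i))

  partOf-pole : ∀ {ρ} s {i} → c (pole ρ s) i ≡ true → partOf ρ i ≡ s
  partOf-pole {ρ} zero {i} ρi with c (partner ρ) i in pi
  ... | false = refl
  ... | true = contradiction (c-closed ρi (c-sym pi) (c-sym (c-partner ρ))) ¬c-refl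
  partOf-pole (suc zero) pi rewrite pi = refl

  Rep : Set
  Rep = Σ (Fin m) λ ρ → rep ρ ≡ ρ

  reps : ∃ λ l → Rep ↔ Fin l
  reps = count (λ ρ → rep ρ ≡ ρ) (λ ρ → rep ρ ≟ ρ) ≡-irrelevant

  l : ℕ
  l = proj₁ reps

  Rep↔l : Rep ↔ Fin l
  Rep↔l = proj₂ reps

  block : Fin m → Fin l
  block i = Inverse.to Rep↔l (rep i , rep-idem i)

  block-cong : ∀ {i j} → rep i ≡ rep j → block i ≡ block j
  block-cong rep-i≡rep-j = cong (Inverse.to Rep↔l) (Σ-≡,≡→≡ (rep-i≡rep-j , ≡-irrelevant _ _))

  block-injective : ∀ {i j} → block i ≡ block j → rep i ≡ rep j
  block-injective bi≡bj = cong proj₁ (to-injective Rep↔l bi≡bj)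

  part : Fin m → Fin 2
  part i = partOf (rep i) i

  c⇔sameBlock×otherPart : ∀ i j → c i j ≡ true ⇔ (block i ≡ block j × part i ≢ part j)
  c⇔sameBlock×otherPart i j = mk⇔
    (λ cij → let ri≡rj = rep-cong (c⇒component cij) in
      block-cong ri≡rj , λ pi≡pj → Equivalence.to (within ri≡rj) cij (trans pi≡pj (part-j ri≡rj)))
    (λ (bi≡bj , pi≢pj) → let ri≡rj = block-injective bi≡bj in
      Equivalence.from (within ri≡rj) λ pi≡pj → pi≢pj (trans pi≡pj (sym (part-j ri≡rj))))
    where
    part-j : rep i ≡ rep j → part j ≡ partOf (rep i) j
    part-j ri≡rj = cong (λ ρ → partOf ρ j) (sym ri≡rj)
    within : rep i ≡ rep j → c i j ≡ true ⇔ partOf (rep i) i ≢ partOf (rep i) j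
    within ri≡rj = c-within (component-rep i) (subst (λ ρ → component ρ j ≡ true) (sym ri≡rj) (component-rep j))

  index : ∀ p {i} → c p i ≡ true → Fin (suc t)
  index p {i} cpi = Inverse.to (nbrs p) (i , cpi)

  index-cong : ∀ {p q i} (cpi : c p i ≡ true) (cqi : c q i ≡ true) → p ≡ q → index p cpi ≡ index q cqi
  index-cong cpi cqi refl = cong (index _) (≡-irrelevant cpi cqi)

  repOf : Fin l → Fin m
  repOf b = proj₁ (Inverse.from Rep↔l b)

  repOf-block : ∀ i → repOf (block i) ≡ rep i
  repOf-block i = cong proj₁ (Inverse.strictlyInverseʳ Rep↔l (rep i , rep-idem i))

  encode : Fin m → (Fin l × Fin 2) × Fin (suc t)
  encode i = (block i , part i) , index (pole (rep i) (part i)) (c-pole (component-rep i))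

  decode : (Fin l × Fin 2) × Fin (suc t) → Fin m
  decode ((b , s) , x) = proj₁ (Inverse.from (nbrs (pole (repOf b) s)) x)

  decode∘encode : ∀ i → decode (encode i) ≡ i
  decode∘encode i = member-index (cong (λ ρ → pole ρ (part i)) (repOf-block i))
    where
    member-index : ∀ {p q} {cpi : c p i ≡ true} → q ≡ p → proj₁ (Inverse.from (nbrs q) (index p cpi)) ≡ i
    member-index {cpi = cpi} refl = cong proj₁ (Inverse.strictlyInverseʳ (nbrs _) (i , cpi))

  encode∘decode : ∀ y → encode (decode y) ≡ y
  encode∘decode ((b , s) , x) = cong₂ _,_ (cong₂ _,_ block-j part-j) index-j
    where
    ρ = repOf b
    ρ-fixed : rep ρ ≡ ρ
    ρ-fixed = proj₂ (Inverse.from Rep↔l b)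
    j = decode ((b , s) , x)
    cj : c (pole ρ s) j ≡ true
    cj = proj₂ (Inverse.from (nbrs (pole ρ s)) x)
    rep-j : rep j ≡ ρ
    rep-j = trans (sym (rep-cong (pole⇒component s cj))) ρ-fixed
    block-j : block j ≡ b
    block-j = trans (cong (Inverse.to Rep↔l) (Σ-≡,≡→≡ (rep-j , ≡-irrelevant _ _)))
                    (Inverse.strictlyInverseˡ Rep↔l b)
    part-j : part j ≡ s
    part-j = trans (cong (λ ρ′ → partOf ρ′ j) rep-j) (partOf-pole s cj)
    index-j : index (pole (rep j) (part j)) (c-pole (component-rep j)) ≡ x
    index-j = trans (index-cong _ cj (cong₂ pole rep-j part-j)) (Inverse.strictlyInverseˡ (nbrs (pole ρ s)) x)

  classification : Isomorphic (boolGraph c) (copiesOfCompleteBipartite l (suc t))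
  classification = mk↔ₛ′ encode decode encode∘decode decode∘encode , c⇔sameBlock×otherPart

module _ {n} (D : BipartiteTournament n) where
  open BipartiteTournament D

  arc⇒¬arc : ∀ {u w} → Arc D w u → arc u w ≡ false
  arc⇒¬arc {u} {w} wu with cross⇒orient w u (arc⇒cross w u wu)
  ... | inj₁ (_ , uw≡false) = uw≡false
  ... | inj₂ (wu≡false , _) = contradiction (trans (sym wu) wu≡false) λ ()

  nicheAdj⇒sameSide : ∀ {u v} → NicheAdj D u v → side u ≡ side v
  nicheAdj⇒sameSide {u} {v} (_ , inj₁ (w , uw , vw)) = ≢-same⇒≡ (arc⇒cross u w uw) (arc⇒cross v w vw)
  nicheAdj⇒sameSide {u} {v} (_ , inj₂ (w , wu , wv)) =
    ≢-same⇒≡ (≢-sym (arc⇒cross w u wu)) (≢-sym (arc⇒cross w v wv))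

  nicheAdj⇒opposite : ∀ {u v} → NicheAdj D u v → ∃ λ y → side y ≢ side u
  nicheAdj⇒opposite {u} (_ , inj₁ (w , uw , _)) = w , ≢-sym (arc⇒cross u w uw)
  nicheAdj⇒opposite {u} (_ , inj₂ (w , wu , _)) = w , arc⇒cross w u wu

  Complementary : Bool → Fin n → Fin n → Set
  Complementary s u v = ∀ y → side y ≢ s → arc u y ≡ not (arc v y)

  ¬nicheAdj⇒complementary : ∀ {s u v} → side u ≡ s → side v ≡ s → u ≢ v → ¬ NicheAdj D u v →
                            Complementary s u v
  ¬nicheAdj⇒complementary {s} {u} {v} u∈s v∈s u≢v ¬uv y y∉s
    with cross⇒orient u y (λ uy → y∉s (trans (sym uy) u∈s)) | cross⇒orient v y (λ vy → y∉s (trans (sym vy) v∈s))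
  ... | inj₁ (uy , _) | inj₁ (vy , _) = contradiction (u≢v , inj₁ (y , uy , vy)) ¬uv
  ... | inj₁ (uy , _) | inj₂ (vy , _) rewrite uy | vy = refl
  ... | inj₂ (uy , _) | inj₁ (vy , _) rewrite uy | vy = refl
  ... | inj₂ (_ , yu) | inj₂ (_ , yv) = contradiction (u≢v , inj₂ (y , yu , yv)) ¬uv

  complementary⇒¬nicheAdj : ∀ {s u v} → side u ≡ s → Complementary s u v → ¬ NicheAdj D u v
  complementary⇒¬nicheAdj {s} {u} {v} u∈s uv (_ , inj₁ (w , uw , vw)) =
    contradiction (trans (sym uw) (trans (uv w w∉s) (cong not vw))) λ ()
    where w∉s = subst (side w ≢_) u∈s (≢-sym (arc⇒cross u w uw))
  complementary⇒¬nicheAdj {s} {u} {v} u∈s uv (_ , inj₂ (w , wu , wv)) =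
    contradiction (trans (sym (arc⇒¬arc wu)) (trans (uv w w∉s) (cong not (arc⇒¬arc wv)))) λ ()
    where w∉s = subst (side w ≢_) u∈s (arc⇒cross w u wu)

  complementary⇒≢ : ∀ {s u v y} → side y ≢ s → Complementary s u v → u ≢ v
  complementary⇒≢ {y = y} y∉s uv refl = not-¬ refl (uv y y∉s)

  complementary-closed : ∀ {s u v w x} → Complementary s u v → Complementary s v w → Complementary s w x →
                         Complementary s u x
  complementary-closed {u = u} {v} {w} {x} uv vw wx y y∉s = begin
    arc u y                  ≡⟨ uv y y∉s ⟩
    not (arc v y)            ≡⟨ cong not (vw y y∉s) ⟩
    not (not (arc w y))      ≡⟨ not-involutive (arc w y) ⟩
    arc w y                  ≡⟨ wx y y∉s ⟩
    not (arc x y)            ∎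
    where open ≡-Reasoning

inhabited-regular : ∀ {R : BoolRel m} {d} → (∀ i → Nbr R i ↔ Fin d) → ∀ {i} → Nbr R i →
                    ∃ λ t → ∀ i → Nbr R i ↔ Fin (suc t)
inhabited-regular {d = zero} nbrs {i} x = contradiction (Inverse.to (nbrs i) x) λ ()
inhabited-regular {d = suc t} nbrs _ = t , nbrs

module InducedSubgraph {n} (G : Graph n) (D : BipartiteTournament n)
  (niche : ∀ u v → Edge G u v ⇔ NicheAdj D u v) (S : Subset n) where
  open BipartiteTournament D using (side)

  H : SGraph
  H = induced G S

  vertices : ∃ λ order → V H ↔ Fin order
  vertices = count (_∈ S) (_∈? S) []=-irrelevant

  order : ℕ
  order = proj₁ vertices

  φ : V H ↔ Fin order
  φ = proj₂ vertices

  ψ : Fin order → Fin n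
  ψ i = proj₁ (Inverse.from φ i)

  ψ-injective : ∀ {i j} → ψ i ≡ ψ j → i ≡ j
  ψ-injective ψi≡ψj = to-injective (↔-sym φ) (Σ-≡,≡→≡ (ψi≡ψj , []=-irrelevant _ _))

  a : BoolRel order
  a i j = Graph.adj G (ψ i) (ψ j)

  a-irrefl : ∀ i → a i i ≡ false
  a-irrefl i = Graph.irrefl G (ψ i)

  c : BoolRel order
  c = co a

  c-irrefl : ∀ i → c i i ≡ false
  c-irrefl = co-irrefl a

  c-sym : ∀ {i j} → c i j ≡ true → c j i ≡ true
  c-sym = co-sym a λ i j → Graph.sym G (ψ i) (ψ j)

  H≅complement : Isomorphic H (complement (boolGraph c))
  H≅complement = begin
    H                          ≅⟨ ≅-transport H φ ⟩
    transport H φ              ≅⟨ ≅-of-⇔ (⇔≢×¬co a a-irrefl) ⟩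
    complement (boolGraph c)   ∎
    where open ≅-Reasoning

  c-regular : Regular H → ∃ λ d → ∀ i → Nbr c i ↔ Fin d
  c-regular reg = _ , co-regular a a-irrefl (proj₂ (transport-regular H φ reg))

  c-edge : ¬ Complete H → ∃₂ λ i j → c i j ≡ true
  c-edge ¬complete with any? (λ i → any? (λ j → c i j ≟ᵇ true))
  ... | yes edge = edge
  ... | no ¬edge = contradiction (Complete-≅ H≅complement λ i j i≢j → i≢j , λ cij → ¬edge (i , j , cij)) ¬complete

  reach⇒sameSide : ∀ {u v} → Reach H u v → side (proj₁ u) ≡ side (proj₁ v)
  reach⇒sameSide here = refl
  reach⇒sameSide (step e uv) = trans (nicheAdj⇒sameSide D (Equivalence.to (niche _ _) e)) (reach⇒sameSide uv)

  module _ (conn : Connected H) {i₀ j₀} (c-i₀j₀ : c i₀ j₀ ≡ true) where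

    s₀ : Bool
    s₀ = side (ψ i₀)

    ψ∈s₀ : ∀ i → side (ψ i) ≡ s₀
    ψ∈s₀ i = reach⇒sameSide (conn (Inverse.from φ i) (Inverse.from φ i₀))

    opposite : ∃ λ y → side y ≢ s₀
    opposite with reach⇒edge (conn (Inverse.from φ i₀) (Inverse.from φ j₀)) (co⇒≢ a c-i₀j₀ ∘ to-injective (↔-sym φ))
    ... | _ , e = nicheAdj⇒opposite D (Equivalence.to (niche _ _) e)

    c⇒complementary : ∀ {i j} → c i j ≡ true → Complementary D s₀ (ψ i) (ψ j)
    c⇒complementary {i} {j} cij = ¬nicheAdj⇒complementary D (ψ∈s₀ i) (ψ∈s₀ j) (co⇒≢ a cij ∘ ψ-injective)
      λ ψiψj → contradiction (trans (sym (Equivalence.from (niche _ _) ψiψj)) (co⇒false a cij)) λ ()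

    complementary⇒c : ∀ {i j} → Complementary D s₀ (ψ i) (ψ j) → c i j ≡ true
    complementary⇒c {i} {j} ψiψj = co-intro a (complementary⇒≢ D (proj₂ opposite) ψiψj ∘ cong ψ)
      (¬-not (complementary⇒¬nicheAdj D (ψ∈s₀ i) ψiψj ∘ Equivalence.to (niche _ _)))

    c-closed : ∀ {i j k l} → c i j ≡ true → c j k ≡ true → c k l ≡ true → c i l ≡ true
    c-closed ij jk kl = complementary⇒c
      (complementary-closed D (c⇒complementary ij) (c⇒complementary jk) (c⇒complementary kl))

proposition4p7 : ∀ {n} (G : Graph n) → NicheRealizable G → (S : Subset n) →
    Connected (induced G S) → Regular (induced G S) → ¬ Complete (induced G S) →
    ∃₂ λ (l t : ℕ) → l ≥ 1 × t ≥ 1 ×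
      Isomorphic (induced G S) (replaceByCliques (CompleteMultipartite l 2) t)
proposition4p7 G (D , niche) S conn reg ¬complete =
  let open InducedSubgraph G D niche S
      open ≅-Reasoning
      i₀ , j₀ , c-i₀j₀ = c-edge ¬complete
      t , c-nbrs = inhabited-regular (proj₂ (c-regular reg)) (j₀ , c-i₀j₀)
      open CompleteBipartiteComponents c c-irrefl c-sym (c-closed conn c-i₀j₀) c-nbrs
  in l , suc t , >-nonZero⁻¹ l {{nonZeroIndex (block i₀)}} , s≤s z≤n ,
       (begin induced G S                                   ≅⟨ H≅complement ⟩
        complement (boolGraph c)                            ≅⟨ ≅-complement {K = copiesOfCompleteBipartite l (suc t)} classification ⟩
        complement (copiesOfCompleteBipartite l (suc t))    ≅⟨ complement-copiesOfCompleteBipartite l (suc t) ⟩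
        replaceByCliques (CompleteMultipartite l 2) (suc t) ∎)
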